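{- Let $\omega\in S_n$. Every basic word in $\mathrm{Basic}(\omega)$ is a reduced word and is braid related to the natural word $\eta_\omega$ of $\omega$ (i.e. is a reduced word of $\omega$).
   Context: $S_n$ is generated by $s_i=(i,i+1)$; a word $i_1\ldots i_l$ represents $s_{i_1}\cdots s_{i_l}$ and is reduced if no shorter word represents the same permutation. Two reduced words are braid related if one is obtained from the other by a sequence of relations $s_is_j=s_js_i$ ($|i-j|\ge2$) and $s_is_{i+1}s_i=s_{i+1}s_is_{i+1}$. A nonempty word $\beta_1\ldots\beta_l$ is a tower word if $\beta_i=\beta_{i-1}+1$ for $1<i\le l$; the tower decomposition of a word is its unique factorization into maximal tower words; $\mathrm{in}(\mathfrak a),\mathrm{fin}(\mathfrak a)$ denote first and last letters of a tower word $\mathfrak a$. The natural word $\eta_\omega$ is the unique reduced word of $\omega$ whose tower decomposition has strictly decreasing initial letters. Track sequence: let $b$ be a positive integer and $\alpha$ a reduced word with tower decomposition $\mathfrak a_1\ldots\mathfrak a_r$ such that $b\mathfrak a_1\ldots\mathfrak a_r$ is reduced. Put $b_0=b$ and for $i\ge1$: $b_i=b_{i-1}-1$ if $\mathrm{in}(\mathfrak a_i)<b_{i-1}\le\mathrm{fin}(\mathfrak a_i)$; $b_i=b_{i-1}$ if $b_{i-1}\le\mathrm{in}(\mathfrak a_i)-2$ or $b_{i-1}\ge\mathrm{fin}(\mathfrak a_i)+2$; otherwise $b_i$ is undefined (and then all later terms are undefined). The track sequence is $b_0,b_1,\ldots,b_s$, the longest sequence of defined terms ($s\le r$). Passage words: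 if $b\alpha$ is not reduced, $\mathrm{passwords}(b,\alpha)=\varnothing$; otherwise $\mathrm{passwords}(b,\alpha)=\{b_0\mathfrak a_1\ldots\mathfrak a_r\}\cup\{\mathfrak a_1\ldots\mathfrak a_i b_i\mathfrak a_{i+1}\ldots\mathfrak a_r:1\le i\le s\}$. For words $\beta=\beta_1\ldots\beta_n$ and $\alpha$: if $\beta\alpha$ is not reduced, $\mathrm{passwords}(\beta,\alpha)=\varnothing$; if $\beta$ is empty, it is $\{\alpha\}$; otherwise $\mathrm{passwords}(\beta_1\ldots\beta_n,\alpha)=\bigcup_{\tilde\alpha\in\mathrm{passwords}(\beta_n,\alpha)}\mathrm{passwords}(\beta_1\ldots\beta_{n-1},\tilde\alpha)$ (tower decompositions being recomputed for each new word). For sets of words $A,B$, $[B,A]=\bigcup_{\alpha\in A,\beta\in B}\mathrm{passwords}(\beta,\alpha)$. Basic words: if $\eta_\omega=\eta_1\ldots\eta_k$ is the tower decomposition of the natural word and $N_i=\{\eta_i\}$, then $\mathrm{Basic}(\omega)=[[\ldots[[N_1,N_2],N_3],\ldots,N_{k-1}],N_k]$. -}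

module Defs where

open import Data.Nat using (ℕ; zero; suc; _+_; _∸_; _≤_; _<_; _≤ᵇ_; _<ᵇ_; _≡ᵇ_)
open import Data.Bool using (Bool; true; false; if_then_else_; _∧_; _∨_)
open import Data.List using (List; []; _∷_; _++_; length; map; concatMap; reverse; [_])
open import Data.List.NonEmpty using (List⁺; _∷_; head; last; toList)
open import Data.List.Relation.Unary.All using (All)
open import Data.List.Relation.Unary.Linked using (Linked)
open import Data.List.Membership.Propositional using (_∈_)
open import Data.Maybe using (Maybe; just; nothing)
open import Data.Product using (Σ; _×_; ∃; ∃-syntax)
open import Data.Sum using (_⊎_)
open import Data.Fin using (Fin; toℕ)
open import Data.Fin.Permutation using (Permutation′; _⟨$⟩ʳ_)
open import Relation.Nullary using (¬_)
open import Relation.Binary.PropositionalEquality using (_≡_)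
open import Relation.Binary.Construct.Closure.Symmetric using (SymClosure)
open import Relation.Binary.Construct.Closure.ReflexiveTransitive using (Star)

-- A word i₁ … i_l (letters are the indices of s_i = (i,i+1), positions 1-indexed).
Word : Set
Word = List ℕ

-- s_i acting on positions ℕ (only positions 1..n matter in S_n).
swap : ℕ → ℕ → ℕ
swap i k = if k ≡ᵇ i then suc i else (if k ≡ᵇ suc i then i else k)

eval : Word → ℕ → ℕ
eval [] k = k
eval (i ∷ w) k = swap i (eval w k)

InAlphabet : ℕ → ℕ → Set
InAlphabet n i = 1 ≤ i × suc i ≤ n

IsWord : ℕ → Word → Set
IsWord n w = All (InAlphabet n) w

Reduced : ℕ → Word → Set
Reduced n w = IsWord n w ×
  (∀ (v : Word) → IsWord n v → length v < length w → ¬ (∀ k → eval v k ≡ eval w k))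

-- the word w represents ω ∈ S_n (Fin n index k corresponds to position k+1)
Represents : (n : ℕ) → Permutation′ n → Word → Set
Represents n ω w = ∀ (k : Fin n) → eval w (suc (toℕ k)) ≡ suc (toℕ (ω ⟨$⟩ʳ k))

data BraidStep : Word → Word → Set where
  comm  : ∀ p q i j → i + 2 ≤ j → BraidStep (p ++ i ∷ j ∷ q) (p ++ j ∷ i ∷ q)
  braid : ∀ p q i → BraidStep (p ++ i ∷ suc i ∷ i ∷ q) (p ++ suc i ∷ i ∷ suc i ∷ q)

BraidRelated : Word → Word → Set
BraidRelated = Star (SymClosure BraidStep)

towers : Word → List (List⁺ ℕ)
towers [] = []
towers (x ∷ xs) with towers xs
... | [] = (x ∷ []) ∷ []
... | (t ∷ ts) = if head t ≡ᵇ suc x then (x ∷ toList t) ∷ ts else (x ∷ []) ∷ t ∷ ts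

concatT : List (List⁺ ℕ) → Word
concatT = concatMap toList

IsNaturalWord : (n : ℕ) → Permutation′ n → Word → Set
IsNaturalWord n ω η = Reduced n η × Represents n ω η × Linked (λ a b → b < a) (map head (towers η))

-- one step of the track sequence: b_{i-1} ↦ b_i using tower 𝔞_i (nothing = undefined)
trackStep : ℕ → List⁺ ℕ → Maybe ℕ
trackStep b t =
  if (head t <ᵇ b) ∧ (b ≤ᵇ last t) then just (b ∸ 1)
  else if (b + 2 ≤ᵇ head t) ∨ (last t + 2 ≤ᵇ b) then just b
  else nothing

-- the words 𝔞₁…𝔞ᵢ bᵢ 𝔞ᵢ₊₁…𝔞ᵣ for 1 ≤ i ≤ s (b = b_{0} of the remaining towers)
trackWords : ℕ → List (List⁺ ℕ) → List Word
trackWords b [] = []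
trackWords b (t ∷ ts) with trackStep b t
... | nothing = []
... | just b′ = (toList t ++ b′ ∷ concatT ts) ∷ map (toList t ++_) (trackWords b′ ts)

PassWord₁ : ℕ → ℕ → Word → Word → Set
PassWord₁ n b α w = Reduced n (b ∷ α) × (w ≡ b ∷ α ⊎ w ∈ trackWords b (towers α))

-- passwords(β, α) with β given reversed (last letter first)
PassWordsRev : ℕ → Word → Word → Word → Set
PassWordsRev n [] α w = Reduced n α × w ≡ α
PassWordsRev n (b ∷ rβ) α w =
  Reduced n (reverse (b ∷ rβ) ++ α) × ∃[ α̃ ] (PassWord₁ n b α α̃ × PassWordsRev n rβ α̃ w)

PassWords : ℕ → Word → Word → Word → Set
PassWords n β α w = PassWordsRev n (reverse β) α w

WordSet : Set₁
WordSet = Word → Set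

bracket : ℕ → WordSet → WordSet → WordSet
bracket n B A w = ∃[ α ] ∃[ β ] (A α × B β × PassWords n β α w)

singleton : Word → WordSet
singleton v w = w ≡ v

-- [[…[[N₁,N₂],N₃],…],N_k], computed as a left fold starting from {ε}
-- (note [{ε}, N₁] = N₁, and for k = 0 the result is {ε})
basicFrom : ℕ → WordSet → List (List⁺ ℕ) → WordSet
basicFrom n S [] = S
basicFrom n S (t ∷ ts) = basicFrom n (bracket n S (singleton (toList t))) ts

Basic : ℕ → Word → WordSet
Basic n η = basicFrom n (singleton []) (towers η)

-- Crossing a tower h, h+1, …, h+k from the left, a letter b with h < b ≤ h+k
-- becomes b-1 (one braid move where it meets the letter b-1, commutations
-- elsewhere), while a letter at distance ≥ 2 from the whole tower passes through
-- unchanged by commutations.  These are exactly the two cases of the track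
-- sequence, so every passage word of (β, α) is braid related to βα, and by
-- induction along the towers every basic word is braid related to the
-- concatenation of the towers of η, which is η.  Reducedness is built into
-- passage words, which are only formed from reduced words.
module Submission where

open import Defs
open import Data.Nat using (ℕ; suc; _+_; _∸_; _≤_; _<_; s≤s; _<ᵇ_; _≤ᵇ_; _≡ᵇ_)
open import Data.Product using (_×_; _,_)
open import Data.Fin.Permutation using (Permutation′)

open import Data.Bool using (true; false; _∧_; _∨_)
open import Data.Bool.Properties using (T-≡; T-∧; T-∨)
open import Data.List using (List; []; _∷_; _++_; reverse; initLast; _∷ʳ′_; [_])
open import Data.List.Properties using (++-assoc; ++-identityʳ; unfold-reverse; reverse-involutive)
open import Data.List.NonEmpty using (List⁺; _∷_; head; last; toList)
open import Data.List.Relation.Unary.All as All using (All; []; _∷_)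
open import Data.List.Relation.Unary.Any using (here; there)
open import Data.List.Membership.Propositional using (_∈_)
open import Data.List.Membership.Propositional.Properties using (∈-map⁻)
open import Data.Maybe using (just; nothing)
open import Data.Maybe.Properties using (just-injective)
open import Data.Nat.Properties
open import Data.Sum as Sum using (_⊎_; inj₁; inj₂)
open import Function.Bundles using (Equivalence)
open import Relation.Nullary using (contradiction)
open import Relation.Binary.PropositionalEquality using (_≡_; refl; sym; trans; cong; subst)
open import Relation.Binary.Construct.Closure.Symmetric as SymClosure using (fwd; bwd)
open import Relation.Binary.Construct.Closure.ReflexiveTransitive as Star using (ε; _◅_; _◅◅_)

open Equivalence using (from; to)

braidStep-++ˡ : ∀ a {u v} → BraidStep u v → BraidStep (a ++ u) (a ++ v)
braidStep-++ˡ a (comm p q i j i+2≤j)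
  rewrite sym (++-assoc a p (i ∷ j ∷ q)) | sym (++-assoc a p (j ∷ i ∷ q)) = comm (a ++ p) q i j i+2≤j
braidStep-++ˡ a (braid p q i)
  rewrite sym (++-assoc a p (i ∷ suc i ∷ i ∷ q)) | sym (++-assoc a p (suc i ∷ i ∷ suc i ∷ q)) = braid (a ++ p) q i

braidStep-++ʳ : ∀ c {u v} → BraidStep u v → BraidStep (u ++ c) (v ++ c)
braidStep-++ʳ c (comm p q i j i+2≤j)
  rewrite ++-assoc p (i ∷ j ∷ q) c | ++-assoc p (j ∷ i ∷ q) c = comm p (q ++ c) i j i+2≤j
braidStep-++ʳ c (braid p q i)
  rewrite ++-assoc p (i ∷ suc i ∷ i ∷ q) c | ++-assoc p (suc i ∷ i ∷ suc i ∷ q) c = braid p (q ++ c) i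

braidRelated-++ˡ : ∀ a {u v} → BraidRelated u v → BraidRelated (a ++ u) (a ++ v)
braidRelated-++ˡ a = Star.gmap (a ++_) (SymClosure.gmap (a ++_) (braidStep-++ˡ a))

braidRelated-++ʳ : ∀ c {u v} → BraidRelated u v → BraidRelated (u ++ c) (v ++ c)
braidRelated-++ʳ c = Star.gmap (_++ c) (SymClosure.gmap (_++ c) (braidStep-++ʳ c))

Far : ℕ → ℕ → Set
Far b x = b + 2 ≤ x ⊎ x + 2 ≤ b

commutes-past : ∀ {b} xs → All (Far b) xs → BraidRelated (b ∷ xs) (xs ++ [ b ])
commutes-past []       []                 = ε
commutes-past (x ∷ xs) (inj₁ b+2≤x ∷ fs) = fwd (comm [] xs _ x b+2≤x) ◅ braidRelated-++ˡ [ x ] (commutes-past xs fs)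
commutes-past (x ∷ xs) (inj₂ x+2≤b ∷ fs) = bwd (comm [] xs x _ x+2≤b) ◅ braidRelated-++ˡ [ x ] (commutes-past xs fs)

ascending : ℕ → ℕ → List ℕ
ascending h 0       = []
ascending h (suc k) = suc h ∷ ascending (suc h) k

data IsTower : List⁺ ℕ → Set where
  tower : ∀ h k → IsTower (h ∷ ascending h k)

isTower-∷ : ∀ {x t} → IsTower t → head t ≡ suc x → IsTower (x ∷ toList t)
isTower-∷ {x} (tower _ k) refl = tower x (suc k)

ascending-bounds : ∀ h k → All (λ x → h < x × x ≤ h + k) (ascending h k)
ascending-bounds h 0       = []
ascending-bounds h (suc k) =
  (n<1+n h , subst (suc h ≤_) (sym (+-suc h k)) (s≤s (m≤m+n h k))) ∷
  All.map (λ (h<x , x≤) → <-trans (n<1+n h) h<x , ≤-trans x≤ (≤-reflexive (sym (+-suc h k))))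
          (ascending-bounds (suc h) k)

tower-bounds : ∀ h k → All (λ x → h ≤ x × x ≤ h + k) (h ∷ ascending h k)
tower-bounds h k = (≤-refl , m≤m+n h k) ∷ All.map (λ (h<x , x≤) → <⇒≤ h<x , x≤) (ascending-bounds h k)

last-∷ : ∀ {A : Set} (x y : A) ys → last (x ∷ y ∷ ys) ≡ last (y ∷ ys)
last-∷ x y ys with initLast ys
... | []       = refl
... | _ ∷ʳ′ _  = refl

last-tower : ∀ h k → last (h ∷ ascending h k) ≡ h + k
last-tower h 0       = sym (+-identityʳ h)
last-tower h (suc k) = trans (last-∷ h (suc h) (ascending (suc h) k)) (trans (last-tower (suc h) k) (sym (+-suc h k)))

2+m≤n⇒m+2≤n : ∀ {m n} → 2 + m ≤ n → m + 2 ≤ n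
2+m≤n⇒m+2≤n {m} {n} = subst (_≤ n) (+-comm 2 m)

crossing-interior : ∀ h k c → h ≤ c → c < h + k →
  BraidRelated (suc c ∷ h ∷ ascending h k) (h ∷ ascending h k ++ [ c ])
crossing-interior h 0       c h≤c c<h+0 = contradiction (subst (_≤ c) (sym (+-identityʳ h)) h≤c) (<⇒≱ c<h+0)
crossing-interior h (suc k) c h≤c c<h+k+1 with m≤n⇒m<n∨m≡n h≤c
... | inj₂ refl =
  bwd (braid [] (ascending (suc h) k) h) ◅
  braidRelated-++ˡ (h ∷ suc h ∷ []) (commutes-past (ascending (suc h) k)
    (All.map (λ (h+1<x , _) → inj₁ (2+m≤n⇒m+2≤n h+1<x)) (ascending-bounds (suc h) k)))
... | inj₁ h<c =
  bwd (comm [] (suc h ∷ ascending (suc h) k) h (suc c) (2+m≤n⇒m+2≤n (s≤s h<c))) ◅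
  braidRelated-++ˡ [ h ] (crossing-interior (suc h) k c h<c (subst (c <_) (+-suc h k) c<h+k+1))

trackStep-just : ∀ b t {b′} → trackStep b t ≡ just b′ →
  (head t < b × b ≤ last t × b′ ≡ b ∸ 1) ⊎ ((b + 2 ≤ head t ⊎ last t + 2 ≤ b) × b′ ≡ b)
trackStep-just b t step with (head t <ᵇ b) ∧ (b ≤ᵇ last t) in interior
... | true =
  let (h<b , b≤l) = to T-∧ (from T-≡ interior)
  in inj₁ (<ᵇ⇒< _ _ h<b , ≤ᵇ⇒≤ _ _ b≤l , sym (just-injective step))
... | false with (b + 2 ≤ᵇ head t) ∨ (last t + 2 ≤ᵇ b) in far
...   | true  = inj₂ (Sum.map (≤ᵇ⇒≤ _ _) (≤ᵇ⇒≤ _ _) (to T-∨ (from T-≡ far)) , sym (just-injective step))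
...   | false with step
...     | ()

crossing-tower : ∀ {b b′ t} → IsTower t → trackStep b t ≡ just b′ →
  BraidRelated (b ∷ toList t) (toList t ++ [ b′ ])
crossing-tower {b} (tower h k) step with trackStep-just b (h ∷ ascending h k) step
... | inj₁ (s≤s h≤c , b≤last , refl) = -- matching s≤s makes b = suc c, so b ∸ 1 is c
  crossing-interior h k _ h≤c (subst (b ≤_) (last-tower h k) b≤last)
... | inj₂ (inj₁ b+2≤h , refl) =
  commutes-past _ (All.map (λ (h≤x , _) → inj₁ (≤-trans b+2≤h h≤x)) (tower-bounds h k))
... | inj₂ (inj₂ last+2≤b , refl) =
  commutes-past _ (All.map (λ (_ , x≤h+k) → inj₂ (≤-trans (+-monoˡ-≤ 2 x≤h+k) h+k+2≤b)) (tower-bounds h k))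
  where
  h+k+2≤b : h + k + 2 ≤ b
  h+k+2≤b = subst (λ l → l + 2 ≤ b) (last-tower h k) last+2≤b

towers-concat : ∀ xs → concatT (towers xs) ≡ xs
towers-concat []       = refl
towers-concat (x ∷ xs) with towers xs | towers-concat xs
... | []     | refl = refl
... | t ∷ ts | eq with head t ≡ᵇ suc x
...   | true  = cong (x ∷_) eq
...   | false = cong (x ∷_) eq

towers-isTower : ∀ xs → All IsTower (towers xs)
towers-isTower []       = []
towers-isTower (x ∷ xs) with towers xs | towers-isTower xs
... | []     | []        = tower x 0 ∷ []
... | t ∷ ts | pt ∷ pts with head t ≡ᵇ suc x in merge
...   | true  = isTower-∷ pt (≡ᵇ⇒≡ _ _ (from T-≡ merge)) ∷ pts
...   | false = tower x 0 ∷ pt ∷ pts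

crossing-tower-++ : ∀ {b b′ t} → IsTower t → trackStep b t ≡ just b′ →
  ∀ c → BraidRelated (b ∷ toList t ++ c) (toList t ++ b′ ∷ c)
crossing-tower-++ {b′ = b′} {t} pt step c =
  subst (BraidRelated _) (++-assoc (toList t) [ b′ ] c) (braidRelated-++ʳ c (crossing-tower pt step))

trackWords-braidRelated : ∀ b {ts w} → All IsTower ts → w ∈ trackWords b ts → BraidRelated (b ∷ concatT ts) w
trackWords-braidRelated b {t ∷ ts} (pt ∷ pts) w∈ with trackStep b t in step
... | nothing with w∈
...   | ()
trackWords-braidRelated b {t ∷ ts} (pt ∷ pts) w∈ | just b′ with w∈
...   | here refl = crossing-tower-++ pt step (concatT ts)
...   | there w∈′ with ∈-map⁻ (toList t ++_) w∈′
...     | _ , w′∈ , refl =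
  crossing-tower-++ pt step (concatT ts) ◅◅ braidRelated-++ˡ (toList t) (trackWords-braidRelated b′ pts w′∈)

passWord₁-braidRelated : ∀ {n b α w} → PassWord₁ n b α w → BraidRelated (b ∷ α) w
passWord₁-braidRelated             (_ , inj₁ refl) = ε
passWord₁-braidRelated {b = b} {α} (_ , inj₂ w∈)   =
  subst (λ α′ → BraidRelated (b ∷ α′) _) (towers-concat α) (trackWords-braidRelated b (towers-isTower α) w∈)

passWordsRev-braidRelated : ∀ {n} rβ {α w} → PassWordsRev n rβ α w → BraidRelated (reverse rβ ++ α) w
passWordsRev-braidRelated []       (_ , refl)               = ε
passWordsRev-braidRelated (b ∷ rβ) {α} (_ , _ , step , rest) =
  subst (λ u → BraidRelated u _) (sym reverse-∷-++)
    (braidRelated-++ˡ (reverse rβ) (passWord₁-braidRelated step) ◅◅ passWordsRev-braidRelated rβ rest)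
  where
  reverse-∷-++ : reverse (b ∷ rβ) ++ α ≡ reverse rβ ++ b ∷ α
  reverse-∷-++ = trans (cong (_++ α) (unfold-reverse b rβ)) (++-assoc (reverse rβ) [ b ] α)

passWords-braidRelated : ∀ {n} β {α w} → PassWords n β α w → BraidRelated (β ++ α) w
passWords-braidRelated β {α} p =
  subst (λ β′ → BraidRelated (β′ ++ α) _) (reverse-involutive β) (passWordsRev-braidRelated (reverse β) p)

passWordsRev-reduced : ∀ {n} rβ {α w} → PassWordsRev n rβ α w → Reduced n w
passWordsRev-reduced []       (red , refl)         = red
passWordsRev-reduced (_ ∷ rβ) (_ , _ , _ , rest) = passWordsRev-reduced rβ rest

bracket-reduced : ∀ {n B A w} → bracket n B A w → Reduced n w
bracket-reduced (_ , β , _ , _ , p) = passWordsRev-reduced (reverse β) p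

basicFrom-reduced : ∀ {n} S ts → (∀ {w} → S w → Reduced n w) → ∀ {w} → basicFrom n S ts w → Reduced n w
basicFrom-reduced S []       red = red
basicFrom-reduced S (t ∷ ts) _   = basicFrom-reduced _ ts bracket-reduced

basicFrom-braidRelated : ∀ {n} S ts {p} → (∀ {w} → S w → BraidRelated p w) →
  ∀ {w} → basicFrom n S ts w → BraidRelated (p ++ concatT ts) w
basicFrom-braidRelated S [] {p} related w∈ =
  subst (λ u → BraidRelated u _) (sym (++-identityʳ p)) (related w∈)
basicFrom-braidRelated {n} S (t ∷ ts) {p} related w∈ =
  subst (λ u → BraidRelated u _) (++-assoc p (toList t) (concatT ts))
    (basicFrom-braidRelated (bracket n S (singleton (toList t))) ts bracket-related w∈)
  where
  bracket-related : ∀ {w} → bracket n S (singleton (toList t)) w → BraidRelated (p ++ toList t) w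
  bracket-related (_ , β , refl , β∈S , pass) =
    braidRelated-++ʳ (toList t) (related β∈S) ◅◅ passWords-braidRelated β pass

reduced-[] : ∀ n → Reduced n []
reduced-[] n = [] , λ _ _ ()

mainTheorem5 : (n : ℕ) (ω : Permutation′ n) (η : Word) → IsNaturalWord n ω η →
    (w : Word) → Basic n η w → Reduced n w × BraidRelated η w
mainTheorem5 n ω η _ w w∈Basic =
  basicFrom-reduced (singleton []) (towers η) (λ { refl → reduced-[] n }) w∈Basic ,
  subst (λ u → BraidRelated u w) (towers-concat η)
    (basicFrom-braidRelated (singleton []) (towers η) (λ { refl → ε }) w∈Basic)
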